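{- Let $W$ be a left $GL^+(2,\mathbb{Q})$-module and $\mu$ an $SL(2,\mathbb{Z})$-modular $W$-valued pseudo-measure. Then the following identity of formal Dirichlet series with coefficients in $W$ holds: $$Z_+(s)\cdot Z_-(s)\cdot LM_\mu(s)=\sum_{n=1}^\infty\frac{(T_n\mu)(\infty,0)}{n^s}.$$
   Context: $\mathbf{P}^1(\mathbb{Q})=\mathbb{Q}\cup\{\infty\}$ with fractional linear action. A $W$-valued pseudo-measure is $\mu:\mathbf{P}^1(\mathbb{Q})^2\to W$ with $\mu(\alpha,\alpha)=0$, $\mu(\alpha,\beta)+\mu(\beta,\alpha)=0$, $\mu(\alpha,\beta)+\mu(\beta,\gamma)+\mu(\gamma,\alpha)=0$; it is $SL(2,\mathbb{Z})$-modular if $\mu(g\alpha,g\beta)=g[\mu(\alpha,\beta)]$ for $g\in SL(2,\mathbb{Z})$. Formal Dirichlet series: for an abelian group $A$, a formal series $\sum_{n\ge1}a_nn^{ -s}$ is just the sequence $(a_n)$; given a biadditive pairing $A\times B\to C$, the product of $\sum a_nn^{ -s}$ and $\sum b_nn^{ -s}$ is $\sum c_nn^{ -s}$ with $c_n=\sum_{d_1d_2=n}a_{d_1}\cdot b_{d_2}$. Here coefficients lie in $\mathbb{Z}[GL^+(2,\mathbb{Q})]$ (acting on $W$ and on itself by multiplication) or in $W$; the left side is $Z_+\cdot(Z_-\cdot LM_\mu)$. Define $Z_-(s)=\sum_{d_1\ge1}\begin{pmatrix}1&0\\0&d_1^{ -1}\end{pmatrix}d_1^{ -s}$ and $Z_+(s)=\sum_{d_2\ge1}\begin{pmatrix}d_2^{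 -1}&0\\0&1\end{pmatrix}d_2^{ -s}$. The Lévy–Mellin transform $LM_\mu(s)$ is defined as $\int_0^{1/2}L(f_\mu)(\alpha,s)\,d\alpha$, where $L(f_\mu)=\sum_{(c,d)}f_\mu(I^-_{c,d})\chi_{I^-_{c,d}}$ is the Lévy function with $f_\mu(I^-_{c,d})(s)=|I^-_{c,d}|^{ -1}d^{ -s}\begin{pmatrix}1&-c/d\\0&1/d\end{pmatrix}[\mu(\infty,c/d)]$; here $(c,d)$ runs over $\overline L=\{(c,d)\in\mathbb{Z}^2:1\le c\le d,\gcd(c,d)=1\}$, $I^-_{1,1}=[0,1/2]$, and for $c<d$, $I^-_{c,d}=[g(0),g(1)]\subset[0,1/2]$ where $g$ is the unique matrix in $GL(2,\mathbb{Z})$ of determinant $-1$ with nonnegative entries non-decreasing to the right in rows and downward in columns and with lower row $(c,d)$; $|I|$ is the length. Integrating term by term, $LM_\mu(s)=\sum_{(c,d)\in\overline L}d^{ -s}\begin{pmatrix}1&-c/d\\0&1/d\end{pmatrix}[\mu(\infty,c/d)]$. The Hecke operator $T_n$ is $(T_n\mu)(\alpha,\beta)=\sum_\delta\delta^{ -1}[\mu(\delta\alpha,\delta\beta)]$, the sum over the matrices $\delta=\begin{pmatrix}a&b\\0&d\end{pmatrix}$ with $a,d\ge1$, $ad=n$, $1\le b\le d$. -}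

module Defs where

open import Level using (Level; _⊔_) renaming (suc to lsuc)
open import Data.Nat as ℕ using (ℕ; zero; suc; NonZero)
import Data.Nat.GCD as ℕGCD
open import Data.Integer as ℤ using (ℤ; +_)
open import Data.Rational as ℚ using (ℚ; 0ℚ; 1ℚ; _÷_; 1/_; Positive)
import Data.Rational.Properties as ℚP
open import Data.Rational.Solver using (module +-*-Solver)
open import Data.List using (List; []; _∷_; upTo; filter; map; concatMap; foldr)
open import Data.Product using (_×_; _,_; Σ; ∃)
open import Relation.Nullary using (yes; no)
open import Relation.Binary.PropositionalEquality using (_≡_; refl; sym; trans; subst; cong)
open import Algebra.Bundles using (AbelianGroup)

record M2 : Set where
  constructor mat
  field
    a b c d : ℚ

open M2 public

det : M2 → ℚ
det m = a m ℚ.* d m ℚ.- b m ℚ.* c m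

_·_ : M2 → M2 → M2
m · n = mat (a m ℚ.* a n ℚ.+ b m ℚ.* c n) (a m ℚ.* b n ℚ.+ b m ℚ.* d n)
            (c m ℚ.* a n ℚ.+ d m ℚ.* c n) (c m ℚ.* b n ℚ.+ d m ℚ.* d n)

I₂ : M2
I₂ = mat 1ℚ 0ℚ 0ℚ 1ℚ

record GL⁺ : Set where
  constructor gl
  field
    mat⁺ : M2
    .pos  : Positive (det mat⁺)

open GL⁺ public

I⁺ : GL⁺
I⁺ = gl I₂ _

inv-mat : (m : M2) → .{{NonZero′ : ℚ.NonZero (det m)}} → M2
inv-mat m = mat (d m ℚ.* u) (ℚ.- b m ℚ.* u) (ℚ.- c m ℚ.* u) (a m ℚ.* u)
  where u = 1/ det m

det-inv : ∀ m → .{{_ : ℚ.NonZero (det m)}} → det (inv-mat m) ≡ 1/ det m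
det-inv m@(mat a₁ b₁ c₁ d₁) =
  trans (solve 5 (λ a₁ b₁ c₁ d₁ u →
           (d₁ :* u) :* (a₁ :* u) :- (:- b₁ :* u) :* (:- c₁ :* u)
         := ((a₁ :* d₁ :- b₁ :* c₁) :* u) :* u) refl a₁ b₁ c₁ d₁ (1/ det m))
   (trans (cong (ℚ._* (1/ det m)) (ℚP.*-inverseʳ (det m))) (ℚP.*-identityˡ (1/ det m)))
  where open +-*-Solver

_⁻¹⁺ : GL⁺ → GL⁺
gl m p ⁻¹⁺ = gl (inv-mat m {{ℚP.pos⇒nonZero (det m) {{p}}}})
                (subst Positive (sym (det-inv m {{ℚP.pos⇒nonZero (det m) {{p}}}}))
                   (ℚP.1/pos⇒pos (det m) {{p}}))

ut-det : ∀ x y z → det (mat x y 0ℚ z) ≡ x ℚ.* z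
ut-det x y z = solve 3 (λ x y z → x :* z :- y :* con 0ℚ := x :* z) refl x y z
  where open +-*-Solver

ut : (x y z : ℚ) → .(Positive x) → .(Positive z) → GL⁺
ut x y z px pz = gl (mat x y 0ℚ z)
  (subst Positive (sym (ut-det x y z)) (ℚP.pos*pos⇒pos x {{px}} z {{pz}}))

ℕ→ℚ : ℕ → ℚ
ℕ→ℚ n = + n ℚ./ 1

recip : (n : ℕ) → .{{NonZero n}} → ℚ
recip n = + 1 ℚ./ n

ℕ→ℚ-pos : ∀ k → Positive (ℕ→ℚ (suc k))
ℕ→ℚ-pos k = ℚP.normalize-pos (suc k) 1

recip-pos : ∀ n .{{_ : NonZero n}} → Positive (recip n)
recip-pos n = ℚP.normalize-pos 1 n

data P1 : Set where
  ∞   : P1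
  fin : ℚ → P1

_•_ : M2 → P1 → P1
m • ∞ with c m ℚ.≟ 0ℚ
... | yes _   = ∞
... | no c≢0  = fin ((a m ÷ c m) {{ℚ.≢-nonZero c≢0}})
m • fin x with c m ℚ.* x ℚ.+ d m ℚ.≟ 0ℚ
... | yes _   = ∞
... | no n≢0  = fin (((a m ℚ.* x ℚ.+ b m) ÷ (c m ℚ.* x ℚ.+ d m)) {{ℚ.≢-nonZero n≢0}})

IsInt : ℚ → Set
IsInt q = ∃ λ (z : ℤ) → q ≡ z ℚ./ 1

record SL2Z : Set where
  constructor sl
  field
    matℤ : M2
    a-int : IsInt (a matℤ)
    b-int : IsInt (b matℤ)
    c-int : IsInt (c matℤ)
    d-int : IsInt (d matℤ)
    det1  : det matℤ ≡ 1ℚ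

open SL2Z public

SL2Z→GL⁺ : SL2Z → GL⁺
SL2Z→GL⁺ g = gl (matℤ g) (subst Positive (sym (det1 g)) _)

record GL⁺Module (c ℓ : Level) : Set (lsuc (c ⊔ ℓ)) where
  field
    W : AbelianGroup c ℓ
  open AbelianGroup W
  field
    act      : GL⁺ → Carrier → Carrier
    act-cong : ∀ g {x y} → x ≈ y → act g x ≈ act g y
    act-∙    : ∀ g x y → act g (x ∙ y) ≈ act g x ∙ act g y
    act-id   : ∀ x → act I⁺ x ≈ x
    act-·    : ∀ g h .(p : Positive (det (mat⁺ g · mat⁺ h))) x →
               act (gl (mat⁺ g · mat⁺ h) p) x ≈ act g (act h x)

-- divisor pairs: (k₁ , k₂) with (k₁+1)(k₂+1) = n
divPairs : ℕ → List (ℕ × ℕ)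
divPairs n = filter (λ p → suc (Data.Product.proj₁ p) ℕ.* suc (Data.Product.proj₂ p) ℕ.≟ n)
                    (concatMap (λ k₁ → map (k₁ ,_) (upTo n)) (upTo n))
  where import Data.Product

-- formal Dirichlet series Σ_{n ≥ 1} a_n n^{-s}, as coefficient sequences
DS : ∀ {ℓ} → Set ℓ → Set ℓ
DS A = (n : ℕ) → .{{NonZero n}} → A

module _ {c ℓ : Level} (M : GL⁺Module c ℓ) where
  open GL⁺Module M
  open AbelianGroup W

  ΣW : List Carrier → Carrier
  ΣW = foldr _∙_ ε

  -- product of a series with coefficients in (group elements of)
  -- ℤ[GL⁺(2,ℚ)] with a W-valued series, via the action pairing
  _⋆_ : DS GL⁺ → DS Carrier → DS Carrier
  (Z ⋆ F) n = ΣW (map (λ p → act (Z (suc (Data.Product.proj₁ p))) (F (suc (Data.Product.proj₂ p))))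
                      (divPairs n))
    where import Data.Product

  _≈ₛ_ : DS Carrier → DS Carrier → Set ℓ
  F ≈ₛ G = ∀ (n : ℕ) .{{_ : NonZero n}} → F n ≈ G n

  record IsPseudoMeasure (μ : P1 → P1 → Carrier) : Set ℓ where
    field
      μ-diag    : ∀ α → μ α α ≈ ε
      μ-anti    : ∀ α β → μ α β ∙ μ β α ≈ ε
      μ-cocycle : ∀ α β γ → μ α β ∙ μ β γ ∙ μ γ α ≈ ε

  IsSL2Z-Modular : (P1 → P1 → Carrier) → Set ℓ
  IsSL2Z-Modular μ = ∀ (g : SL2Z) α β →
    μ (matℤ g • α) (matℤ g • β) ≈ act (SL2Z→GL⁺ g) (μ α β)

  -- Lévy–Mellin transform (term-by-term integrated form):
  -- coefficient at d is Σ_{1≤c≤d, gcd(c,d)=1} [[1,-c/d],[0,1/d]] μ(∞, c/d)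
  LM : (P1 → P1 → Carrier) → DS Carrier
  LM μ d = ΣW (map (λ j → act (ut 1ℚ (ℚ.- (+ suc j ℚ./ d)) (recip d) _ (recip-pos d))
                              (μ ∞ (fin (+ suc j ℚ./ d))))
                   (filter (λ j → ℕGCD.gcd (suc j) d ℕ.≟ 1) (upTo d)))

  Z₋ : DS GL⁺
  Z₋ d = ut 1ℚ 0ℚ (recip d) _ (recip-pos d)

  Z₊ : DS GL⁺
  Z₊ d = ut (recip d) 0ℚ 1ℚ (recip-pos d) _

  δ : ℕ → ℕ → ℕ → GL⁺
  δ ka kb kd = ut (ℕ→ℚ (suc ka)) (ℕ→ℚ (suc kb)) (ℕ→ℚ (suc kd)) (ℕ→ℚ-pos ka) (ℕ→ℚ-pos kd)

  -- Hecke operator: (T_n μ)(α,β) = Σ_δ δ⁻¹ [μ(δα, δβ)],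
  -- δ = [[a,b],[0,d]], a,d ≥ 1, ad = n, 1 ≤ b ≤ d
  T : ℕ → (P1 → P1 → Carrier) → (P1 → P1 → Carrier)
  T n μ α β =
    ΣW (concatMap (λ p → map (λ kb → let g = δ (Data.Product.proj₁ p) kb (Data.Product.proj₂ p)
                                      in act (g ⁻¹⁺) (μ (mat⁺ g • α) (mat⁺ g • β)))
                             (upTo (suc (Data.Product.proj₂ p))))
                  (divPairs n))
    where import Data.Product

  HeckeSeries : (P1 → P1 → Carrier) → DS Carrier
  HeckeSeries μ n = T n μ ∞ (fin 0ℚ)

-- Both sides are sums over n = a e. The Hecke term of δ = [[a, b], [0, e]] is δ⁻¹ μ(∞, b/e),
-- as δ fixes ∞ and sends 0 to b/e. Writing b/e in lowest terms c/d, with d₁ = gcd(b, e),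
-- e = d₁ d and b = c d₁, one has δ⁻¹ = diag(1/a, 1) diag(1, 1/d₁) [[1, -c/d], [0, 1/d]],
-- which is exactly the coefficient of the term of Z₊ Z₋ LM_μ indexed by (a, d₁, c, d).
-- As b runs through 1, …, e, every (d₁, c, d) with d₁ d = e and gcd(c, d) = 1 occurs
-- exactly once, so the identity is a reindexing of finite sums.
-- Natural-number variables named x-1 stand for x - 1, matching divPairs and δ.

module Submission where

open import Defs
open import Level using (Level; 0ℓ)
open import Algebra.Bundles using (AbelianGroup)
import Algebra.Properties.Group as GroupProperties
open import Data.Nat as ℕ using (ℕ; zero; suc)
import Data.Nat.Properties as ℕP
import Data.Nat.Tactic.RingSolver as ℕ-Solver
open import Data.Nat.Divisibility using (_∣_; divides; ∣⇒≤; ∣m+n∣m⇒∣n; ∣-refl)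
open import Data.Nat.GCD using (gcd; gcd[m,n]∣m; gcd[m,n]∣n; gcd[m,n]≢0; c*gcd[m,n]≡gcd[cm,cn])
import Data.Integer as ℤ
import Data.Integer.Properties as ℤP
open import Data.Rational as ℚ using (ℚ; 0ℚ; 1ℚ; Positive)
import Data.Rational.Properties as ℚP
import Data.Rational.Unnormalised as ℚᵘ
import Data.Rational.Unnormalised.Properties as ℚᵘP
import Data.Maybe as Maybe
open import Data.List using (List; []; _∷_; _++_; map; concatMap; filter; upTo; applyUpTo; foldr)
import Data.List.Properties as List
open import Data.Product using (_×_; _,_; proj₁; proj₂)
open import Data.Sum using (inj₁)
open import Function using (_∘_; _⇔_; mk⇔; Equivalence)
open import Relation.Nullary using (Dec; yes; no; ¬_; contradiction)
open import Relation.Nullary.Decidable using (dec⇒maybe)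
open import Relation.Binary.PropositionalEquality as ≡ using (_≡_; _≢_)
open import Tactic.RingSolver using (solve)
open import Tactic.RingSolver.Core.AlmostCommutativeRing using (AlmostCommutativeRing; fromCommutativeRing)

module FiniteSums {c ℓ : Level} (G : AbelianGroup c ℓ) where
  open AbelianGroup G
  open import Algebra.Properties.CommutativeSemigroup commutativeSemigroup using (interchange)
  open import Data.Nat using (_<_; _+_; _*_; _≟_; s≤s; z≤n)
  open import Relation.Binary.Reasoning.Setoid setoid

  ∑ˡ : List Carrier → Carrier
  ∑ˡ = foldr _∙_ ε

  sum< : ℕ → (ℕ → Carrier) → Carrier
  sum< zero    f = ε
  sum< (suc n) f = f 0 ∙ sum< n (f ∘ suc)

  syntax sum< n (λ i → x) = ∑[ i < n ] x

  when : ∀ {p} {P : Set p} → Dec P → Carrier → Carrier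
  when (yes _) x = x
  when (no _)  _ = ε

  ∑-cong : ∀ n {f g} → (∀ i → i < n → f i ≈ g i) → sum< n f ≈ sum< n g
  ∑-cong zero    f≈g = refl
  ∑-cong (suc n) f≈g = ∙-cong (f≈g 0 (s≤s z≤n)) (∑-cong n (λ i i<n → f≈g (suc i) (s≤s i<n)))

  ∑-ε : ∀ n {f} → (∀ i → i < n → f i ≈ ε) → sum< n f ≈ ε
  ∑-ε n f≈ε = trans (∑-cong n f≈ε) (∑-const-ε n)
    where
    ∑-const-ε : ∀ n → sum< n (λ _ → ε) ≈ ε
    ∑-const-ε zero    = refl
    ∑-const-ε (suc n) = trans (identityˡ _) (∑-const-ε n)

  ∑-distrib-∙ : ∀ n f g → ∑[ i < n ] (f i ∙ g i) ≈ sum< n f ∙ sum< n g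
  ∑-distrib-∙ zero    f g = sym (identityˡ ε)
  ∑-distrib-∙ (suc n) f g = trans (∙-congˡ (∑-distrib-∙ n (f ∘ suc) (g ∘ suc))) (interchange _ _ _ _)

  ∑-comm : ∀ m n (f : ℕ → ℕ → Carrier) → ∑[ i < m ] ∑[ j < n ] f i j ≈ ∑[ j < n ] ∑[ i < m ] f i j
  ∑-comm zero    n f = sym (∑-ε n (λ _ _ → refl))
  ∑-comm (suc m) n f = trans (∙-congˡ (∑-comm m n (f ∘ suc))) (sym (∑-distrib-∙ n (f 0) _))

  ∑-+ : ∀ m n f → sum< (m + n) f ≈ sum< m f ∙ ∑[ i < n ] f (m + i)
  ∑-+ zero    n f = sym (identityˡ _)
  ∑-+ (suc m) n f = trans (∙-congˡ (∑-+ m n (f ∘ suc))) (sym (assoc _ _ _))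

  ∑-init-last : ∀ n f → sum< (suc n) f ≈ sum< n f ∙ f n
  ∑-init-last zero    f = trans (identityʳ _) (sym (identityˡ _))
  ∑-init-last (suc n) f = trans (∙-congˡ (∑-init-last n (f ∘ suc))) (sym (assoc _ _ _))

  when-cong : ∀ {p} {P : Set p} (P? : Dec P) {x y} → (P → x ≈ y) → when P? x ≈ when P? y
  when-cong (yes p) x≈y = x≈y p
  when-cong (no _)  _   = refl

  when-yes : ∀ {p} {P : Set p} (P? : Dec P) x → P → when P? x ≈ x
  when-yes (yes _) x _ = refl
  when-yes (no ¬p) x p = contradiction p ¬p

  when-no : ∀ {p} {P : Set p} (P? : Dec P) x → ¬ P → when P? x ≈ ε
  when-no (yes p) x ¬p = contradiction p ¬p
  when-no (no _)  x _  = refl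

  when-⇔ : ∀ {p q} {P : Set p} {Q : Set q} (P? : Dec P) (Q? : Dec Q) x → P ⇔ Q → when P? x ≈ when Q? x
  when-⇔ (yes _) (yes _) x _   = refl
  when-⇔ (yes p) (no ¬q) x P⇔Q = contradiction (Equivalence.to P⇔Q p) ¬q
  when-⇔ (no ¬p) (yes q) x P⇔Q = contradiction (Equivalence.from P⇔Q q) ¬p
  when-⇔ (no _)  (no _)  x _   = refl

  when-comm : ∀ {p q} {P : Set p} {Q : Set q} (P? : Dec P) (Q? : Dec Q) x → when P? (when Q? x) ≈ when Q? (when P? x)
  when-comm (yes _) Q?      x = refl
  when-comm (no _)  (yes _) x = refl
  when-comm (no _)  (no _)  x = refl

  when-∑ : ∀ {p} {P : Set p} (P? : Dec P) n f → when P? (sum< n f) ≈ ∑[ i < n ] when P? (f i)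
  when-∑ (yes _) n f = refl
  when-∑ (no _)  n f = sym (∑-ε n (λ _ _ → refl))

  ∑-unique : ∀ n {p} {P : ℕ → Set p} (P? : ∀ i → Dec (P i)) (f : ℕ → Carrier) {m} →
             m < n → P m → (∀ i → P i → i ≡ m) → ∑[ i < n ] when (P? i) (f i) ≈ f m
  ∑-unique (suc n) P? f {zero} _ Pm unique = begin
    when (P? 0) (f 0) ∙ ∑[ i < n ] when (P? (suc i)) (f (suc i))
      ≈⟨ ∙-cong (when-yes (P? 0) (f 0) Pm) (∑-ε n (λ i _ → when-no (P? (suc i)) _ (ℕP.1+n≢0 ∘ unique (suc i)))) ⟩
    f 0 ∙ ε
      ≈⟨ identityʳ (f 0) ⟩
    f 0 ∎
  ∑-unique (suc n) P? f {suc m} (s≤s m<n) Pm unique = begin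
    when (P? 0) (f 0) ∙ ∑[ i < n ] when (P? (suc i)) (f (suc i))
      ≈⟨ ∙-cong (when-no (P? 0) (f 0) (ℕP.0≢1+n ∘ unique 0))
                (∑-unique n (P? ∘ suc) (f ∘ suc) m<n Pm (λ i → ℕP.suc-injective ∘ unique (suc i))) ⟩
    ε ∙ f (suc m)
      ≈⟨ identityˡ (f (suc m)) ⟩
    f (suc m) ∎

  ∑ˡ-++ : ∀ xs ys → ∑ˡ (xs ++ ys) ≈ ∑ˡ xs ∙ ∑ˡ ys
  ∑ˡ-++ []       ys = sym (identityˡ _)
  ∑ˡ-++ (x ∷ xs) ys = trans (∙-congˡ (∑ˡ-++ xs ys)) (sym (assoc _ _ _))

  ∑ˡ-map-cong : ∀ {a} {A : Set a} {f g : A → Carrier} xs → (∀ x → f x ≈ g x) → ∑ˡ (map f xs) ≈ ∑ˡ (map g xs)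
  ∑ˡ-map-cong []       f≈g = refl
  ∑ˡ-map-cong (x ∷ xs) f≈g = ∙-cong (f≈g x) (∑ˡ-map-cong xs f≈g)

  ∑ˡ-concatMap : ∀ {a} {A : Set a} (g : A → List Carrier) xs → ∑ˡ (concatMap g xs) ≈ ∑ˡ (map (∑ˡ ∘ g) xs)
  ∑ˡ-concatMap g []       = refl
  ∑ˡ-concatMap g (x ∷ xs) = trans (∑ˡ-++ (g x) (concatMap g xs)) (∙-congˡ (∑ˡ-concatMap g xs))

  ∑ˡ-filter : ∀ {a p} {A : Set a} {P : A → Set p} (P? : ∀ x → Dec (P x)) (f : A → Carrier) xs →
              ∑ˡ (map f (filter P? xs)) ≈ ∑ˡ (map (λ x → when (P? x) (f x)) xs)
  ∑ˡ-filter P? f []       = refl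
  ∑ˡ-filter P? f (x ∷ xs) with P? x
  ... | yes _ = ∙-congˡ (∑ˡ-filter P? f xs)
  ... | no _  = trans (∑ˡ-filter P? f xs) (sym (identityˡ _))

  ∑ˡ-applyUpTo : ∀ f n → ∑ˡ (applyUpTo f n) ≈ sum< n f
  ∑ˡ-applyUpTo f zero    = refl
  ∑ˡ-applyUpTo f (suc n) = ∙-congˡ (∑ˡ-applyUpTo (f ∘ suc) n)

  ∑ˡ-upTo : ∀ f n → ∑ˡ (map f (upTo n)) ≈ sum< n f
  ∑ˡ-upTo f n = trans (reflexive (≡.cong ∑ˡ (List.map-upTo f n))) (∑ˡ-applyUpTo f n)

  ∑divPairs : ℕ → (ℕ → ℕ → Carrier) → Carrier
  ∑divPairs n g = ∑[ i < n ] ∑[ j < n ] when (suc i * suc j ≟ n) (g i j)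

  ∑divPairs-cong : ∀ n {g h} → (∀ i j → suc i * suc j ≡ n → g i j ≈ h i j) → ∑divPairs n g ≈ ∑divPairs n h
  ∑divPairs-cong n g≈h = ∑-cong n (λ i _ → ∑-cong n (λ j _ → when-cong (suc i * suc j ≟ n) (g≈h i j)))

  ∑divPairs-∑-comm : ∀ n m (h : ℕ → ℕ → ℕ → Carrier) →
    ∑divPairs n (λ i j → ∑[ b < m ] h i j b) ≈ ∑[ b < m ] ∑divPairs n (λ i j → h i j b)
  ∑divPairs-∑-comm n m h = begin
    ∑[ i < n ] ∑[ j < n ] when (P? i j) (∑[ b < m ] h i j b)
      ≈⟨ ∑-cong n (λ i _ → ∑-cong n (λ j _ → when-∑ (P? i j) m (h i j))) ⟩
    ∑[ i < n ] ∑[ j < n ] ∑[ b < m ] when (P? i j) (h i j b)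
      ≈⟨ ∑-cong n (λ i _ → ∑-comm n m (λ j b → when (P? i j) (h i j b))) ⟩
    ∑[ i < n ] ∑[ b < m ] ∑[ j < n ] when (P? i j) (h i j b)
      ≈⟨ ∑-comm n m (λ i b → ∑[ j < n ] when (P? i j) (h i j b)) ⟩
    ∑[ b < m ] ∑[ i < n ] ∑[ j < n ] when (P? i j) (h i j b) ∎
    where
    P? : ∀ i j → Dec (suc i * suc j ≡ n)
    P? i j = suc i * suc j ≟ n

  ∑ˡ-divPairs : ∀ n (f : ℕ × ℕ → Carrier) → ∑ˡ (map f (divPairs n)) ≈ ∑divPairs n (λ i j → f (i , j))
  ∑ˡ-divPairs n f = begin
    ∑ˡ (map f (filter P? pairs))
      ≈⟨ ∑ˡ-filter P? f pairs ⟩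
    ∑ˡ (map F pairs)
      ≡⟨ ≡.cong ∑ˡ (List.map-concatMap F row (upTo n)) ⟩
    ∑ˡ (concatMap (map F ∘ row) (upTo n))
      ≈⟨ ∑ˡ-concatMap (map F ∘ row) (upTo n) ⟩
    ∑ˡ (map (∑ˡ ∘ map F ∘ row) (upTo n))
      ≈⟨ ∑ˡ-upTo (∑ˡ ∘ map F ∘ row) n ⟩
    ∑[ i < n ] ∑ˡ (map F (row i))
      ≈⟨ ∑-cong n (λ i _ → trans (reflexive (≡.cong ∑ˡ (≡.sym (List.map-∘ (upTo n)))))
                                 (∑ˡ-upTo (λ j → F (i , j)) n)) ⟩
    ∑[ i < n ] ∑[ j < n ] F (i , j) ∎
    where
    P? : ∀ p → Dec (suc (proj₁ p) * suc (proj₂ p) ≡ n)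
    P? p = suc (proj₁ p) * suc (proj₂ p) ≟ n
    F : ℕ × ℕ → Carrier
    F p = when (P? p) (f p)
    row : ℕ → List (ℕ × ℕ)
    row i = map (i ,_) (upTo n)
    pairs : List (ℕ × ℕ)
    pairs = concatMap row (upTo n)

  module Endomorphism (φ : Carrier → Carrier) (φ-cong : ∀ {x y} → x ≈ y → φ x ≈ φ y)
                      (φ-∙ : ∀ x y → φ (x ∙ y) ≈ φ x ∙ φ y) where

    φ-ε : φ ε ≈ ε
    φ-ε = GroupProperties.identityˡ-unique group (φ ε) (φ ε) (trans (sym (φ-∙ ε ε)) (φ-cong (identityˡ ε)))

    φ-∑ : ∀ n f → φ (sum< n f) ≈ ∑[ i < n ] φ (f i)
    φ-∑ zero    f = φ-ε
    φ-∑ (suc n) f = trans (φ-∙ _ _) (∙-congˡ (φ-∑ n (f ∘ suc)))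

    φ-when : ∀ {p} {P : Set p} (P? : Dec P) x → φ (when P? x) ≈ when P? (φ x)
    φ-when (yes _) x = refl
    φ-when (no _)  x = φ-ε

    φ-∑-when : ∀ n {p} {P : ℕ → Set p} (P? : ∀ i → Dec (P i)) (f : ℕ → Carrier) →
               φ (∑[ i < n ] when (P? i) (f i)) ≈ ∑[ i < n ] when (P? i) (φ (f i))
    φ-∑-when n P? f = trans (φ-∑ n (λ i → when (P? i) (f i))) (∑-cong n (λ i _ → φ-when (P? i) (f i)))

    φ-∑divPairs : ∀ n g → φ (∑divPairs n g) ≈ ∑divPairs n (λ i j → φ (g i j))
    φ-∑divPairs n g = trans (φ-∑ n _) (∑-cong n (λ i _ →
      trans (φ-∑ n _) (∑-cong n (λ j _ → φ-when (suc i * suc j ≟ n) (g i j)))))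

module DivisorSums {c ℓ : Level} (G : AbelianGroup c ℓ) where
  open AbelianGroup G
  open FiniteSums G
  open import Data.Nat using (_≤_; _+_; _*_; _≟_; s≤s)
  open import Relation.Binary.Reasoning.Setoid setoid

  coprime? : ∀ c-1 d-1 → Dec (gcd (suc c-1) (suc d-1) ≡ 1)
  coprime? c-1 d-1 = gcd (suc c-1) (suc d-1) ≟ 1

  ∑divPairs-divisor : ∀ k {d} → d ≢ 0 → d ∣ suc k → ∀ x → ∑divPairs (suc k) (λ i _ → when (d ≟ suc i) x) ≈ x
  ∑divPairs-divisor k {zero}  d≢0 _ x = contradiction ≡.refl d≢0
  ∑divPairs-divisor k {suc m} _ (divides zero ()) x
  ∑divPairs-divisor k {suc m} _ (divides (suc q) n≡qd) x = begin
    ∑[ i < n ] ∑[ j < n ] when (P? i j) (when (suc m ≟ suc i) x)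
      ≈⟨ ∑-cong n (λ i _ → ∑-cong n (λ j _ → when-comm (P? i j) (suc m ≟ suc i) x)) ⟩
    ∑[ i < n ] ∑[ j < n ] when (suc m ≟ suc i) (when (P? i j) x)
      ≈⟨ ∑-cong n (λ i _ → when-∑ (suc m ≟ suc i) n (λ j → when (P? i j) x)) ⟨
    ∑[ i < n ] when (suc m ≟ suc i) (∑[ j < n ] when (P? i j) x)
      ≈⟨ ∑-unique n (λ i → suc m ≟ suc i) (λ i → ∑[ j < n ] when (P? i j) x)
           (∣⇒≤ (divides (suc q) n≡qd)) ≡.refl (λ i → ≡.sym ∘ ℕP.suc-injective) ⟩
    ∑[ j < n ] when (P? m j) x
      ≈⟨ ∑-unique n (P? m) (λ _ → x) (≡.subst (suc q ≤_) dq≡n (ℕP.m≤n*m (suc q) (suc m))) dq≡n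
           (λ j dj≡n → ℕP.suc-injective (ℕP.*-cancelˡ-≡ (suc j) (suc q) (suc m) (≡.trans dj≡n (≡.sym dq≡n)))) ⟩
    x ∎
    where
    n = suc k
    P? : ∀ i j → Dec (suc i * suc j ≡ n)
    P? i j = suc i * suc j ≟ n
    dq≡n : suc m * suc q ≡ n
    dq≡n = ≡.trans (ℕP.*-comm (suc m) (suc q)) (≡.sym n≡qd)

  ∑-multiples : ∀ k m (Q : ℕ → Carrier) → (∀ x → ¬ suc k ∣ x → Q x ≈ ε) →
                ∑[ b < m * suc k ] Q (suc b) ≈ ∑[ j < m ] Q (suc j * suc k)
  ∑-multiples k zero    Q Q≈ε = refl
  ∑-multiples k (suc m) Q Q≈ε = begin
    ∑[ b < suc k + m * suc k ] Q (suc b)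
      ≈⟨ ∑-+ (suc k) (m * suc k) (Q ∘ suc) ⟩
    ∑[ b < suc k ] Q (suc b) ∙ ∑[ i < m * suc k ] Q (suc (suc k + i))
      ≈⟨ ∙-cong first-block (∑-cong (m * suc k) (λ i _ → reflexive (≡.cong Q (≡.sym (ℕP.+-suc (suc k) i))))) ⟩
    Q (1 * suc k) ∙ ∑[ i < m * suc k ] Q (suc k + suc i)
      ≈⟨ ∙-congˡ (∑-multiples k m (Q ∘ (suc k +_))
                   (λ x k∤x → Q≈ε (suc k + x) (λ k∣k+x → k∤x (∣m+n∣m⇒∣n k∣k+x ∣-refl)))) ⟩
    Q (1 * suc k) ∙ ∑[ j < m ] Q (suc k + suc j * suc k) ∎
    where
    first-block : ∑[ b < suc k ] Q (suc b) ≈ Q (1 * suc k)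
    first-block = begin
      ∑[ b < suc k ] Q (suc b)  ≈⟨ ∑-init-last k (Q ∘ suc) ⟩
      ∑[ b < k ] Q (suc b) ∙ Q (suc k)
        ≈⟨ ∙-congʳ (∑-ε k (λ b b<k → Q≈ε (suc b) (λ k∣b → ℕP.<⇒≱ (s≤s b<k) (∣⇒≤ k∣b)))) ⟩
      ε ∙ Q (suc k)             ≈⟨ identityˡ _ ⟩
      Q (suc k)                 ≡⟨ ≡.cong Q (ℕP.*-identityˡ (suc k)) ⟨
      Q (1 * suc k)             ∎

  ∑-coprime-scaled : ∀ i j (f : ℕ → Carrier) →
    ∑[ c < suc j ] when (coprime? c j) (f (suc c * suc i))
      ≈ ∑[ b < suc i * suc j ] when (gcd (suc b) (suc i * suc j) ≟ suc i) (f (suc b))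
  ∑-coprime-scaled i j f = begin
    ∑[ c < suc j ] when (coprime? c j) (f (suc c * suc i))
      ≈⟨ ∑-cong (suc j) (λ c _ → when-⇔ (coprime? c j) (gcd (suc c * suc i) n ≟ suc i) (f (suc c * suc i)) (coprime⇔gcd≡ c)) ⟩
    ∑[ c < suc j ] Q (suc c * suc i)
      ≈⟨ ∑-multiples i (suc j) Q Q≈ε ⟨
    ∑[ b < suc j * suc i ] Q (suc b)
      ≡⟨ ≡.cong (λ m → ∑[ b < m ] Q (suc b)) (ℕP.*-comm (suc j) (suc i)) ⟩
    ∑[ b < n ] Q (suc b) ∎
    where
    n = suc i * suc j
    Q : ℕ → Carrier
    Q x = when (gcd x n ≟ suc i) (f x)
    Q≈ε : ∀ x → ¬ suc i ∣ x → Q x ≈ ε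
    Q≈ε x i∤x = when-no (gcd x n ≟ suc i) (f x) (λ g≡i → i∤x (≡.subst (_∣ x) g≡i (gcd[m,n]∣m x n)))
    gcd-scaled : ∀ c → gcd (suc c * suc i) n ≡ suc i * gcd (suc c) (suc j)
    gcd-scaled c = ≡.trans (≡.cong (λ x → gcd x n) (ℕP.*-comm (suc c) (suc i)))
                           (≡.sym (c*gcd[m,n]≡gcd[cm,cn] (suc i) (suc c) (suc j)))
    coprime⇔gcd≡ : ∀ c → (gcd (suc c) (suc j) ≡ 1) ⇔ (gcd (suc c * suc i) n ≡ suc i)
    coprime⇔gcd≡ c = mk⇔
      (λ g≡1 → ≡.trans (gcd-scaled c) (≡.trans (≡.cong (suc i *_) g≡1) (ℕP.*-identityʳ (suc i))))
      (λ g≡i → ℕP.*-cancelˡ-≡ _ 1 (suc i) (≡.trans (≡.sym (gcd-scaled c)) (≡.trans g≡i (≡.sym (ℕP.*-identityʳ (suc i))))))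

  ∑divPairs-coprime : ∀ k (f : ℕ → Carrier) →
    ∑divPairs (suc k) (λ i j → ∑[ c < suc j ] when (coprime? c j) (f (suc c * suc i)))
      ≈ ∑[ b < suc k ] f (suc b)
  ∑divPairs-coprime k f = begin
    ∑divPairs n (λ i j → ∑[ c < suc j ] when (coprime? c j) (f (suc c * suc i)))
      ≈⟨ ∑divPairs-cong n (λ i j ij≡n → trans (∑-coprime-scaled i j f)
           (reflexive (≡.cong (λ m → ∑[ b < m ] when (gcd (suc b) m ≟ suc i) (f (suc b))) ij≡n))) ⟩
    ∑divPairs n (λ i j → ∑[ b < n ] when (gcd (suc b) n ≟ suc i) (f (suc b)))
      ≈⟨ ∑divPairs-∑-comm n n (λ i j b → when (gcd (suc b) n ≟ suc i) (f (suc b))) ⟩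
    ∑[ b < n ] ∑divPairs n (λ i j → when (gcd (suc b) n ≟ suc i) (f (suc b)))
      ≈⟨ ∑-cong n (λ b _ → ∑divPairs-divisor k (gcd[m,n]≢0 (suc b) n (inj₁ λ ())) (gcd[m,n]∣n (suc b) n) (f (suc b))) ⟩
    ∑[ b < n ] f (suc b) ∎
    where n = suc k

module Rationals where
  open import Data.Integer using (+_)
  open import Data.Rational using (_*_)
  open ≡ using (_≡_; refl; sym; trans; cong)

  -- A genuine zero test is needed: without it the solver cannot cancel coefficients such as 0ℚ * x.
  ℚ-ring : AlmostCommutativeRing 0ℓ 0ℓ
  ℚ-ring = fromCommutativeRing ℚP.+-*-commutativeRing (Maybe.map sym ∘ dec⇒maybe ∘ (ℚ._≟ 0ℚ))

  ≡-by-units : ∀ {x y s t} → s ≡ 1ℚ → t ≡ 1ℚ → x * s ≡ y * t → x ≡ y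
  ≡-by-units {x} {y} refl refl x≡y = trans (sym (ℚP.*-identityʳ x)) (trans x≡y (ℚP.*-identityʳ y))

  *-≡1 : ∀ {x y} → x ≡ 1ℚ → y ≡ 1ℚ → x * y ≡ 1ℚ
  *-≡1 refl refl = refl

  -- + m / suc n is fromℚᵘ (mkℚᵘ (+ m) n) by definition, so the product can be computed in ℚᵘ.
  frac-* : ∀ m n m′ n′ → (+ m ℚ./ suc n) * (+ m′ ℚ./ suc n′) ≡ + (m ℕ.* m′) ℚ./ (suc n ℕ.* suc n′)
  frac-* m n m′ n′ = ℚP.toℚᵘ-injective (begin
    ℚ.toℚᵘ ((+ m ℚ./ suc n) * (+ m′ ℚ./ suc n′))
      ≈⟨ ℚP.toℚᵘ-homo-* (+ m ℚ./ suc n) (+ m′ ℚ./ suc n′) ⟩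
    ℚ.toℚᵘ (+ m ℚ./ suc n) ℚᵘ.* ℚ.toℚᵘ (+ m′ ℚ./ suc n′)
      ≈⟨ ℚᵘP.*-cong (ℚP.toℚᵘ-fromℚᵘ (ℚᵘ.mkℚᵘ (+ m) n)) (ℚP.toℚᵘ-fromℚᵘ (ℚᵘ.mkℚᵘ (+ m′) n′)) ⟩
    ℚᵘ.mkℚᵘ (+ m ℤ.* + m′) (n′ ℕ.+ n ℕ.* suc n′)
      ≡⟨ cong (λ k → ℚᵘ.mkℚᵘ k (n′ ℕ.+ n ℕ.* suc n′)) (sym (ℤP.pos-* m m′)) ⟩
    ℚᵘ.mkℚᵘ (+ (m ℕ.* m′)) (n′ ℕ.+ n ℕ.* suc n′)
      ≈⟨ ℚP.toℚᵘ-fromℚᵘ (ℚᵘ.mkℚᵘ (+ (m ℕ.* m′)) (n′ ℕ.+ n ℕ.* suc n′)) ⟨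
    ℚ.toℚᵘ (+ (m ℕ.* m′) ℚ./ (suc n ℕ.* suc n′)) ∎)
    where open import Relation.Binary.Reasoning.Setoid ℚᵘP.≃-setoid

  frac-≡ : ∀ m n m′ n′ → m ℕ.* suc n′ ≡ m′ ℕ.* suc n → + m ℚ./ suc n ≡ + m′ ℚ./ suc n′
  frac-≡ m n m′ n′ eq = ℚP.fromℚᵘ-cong {ℚᵘ.mkℚᵘ (+ m) n} {ℚᵘ.mkℚᵘ (+ m′) n′}
    (ℚᵘ.*≡* (trans (sym (ℤP.pos-* m (suc n′))) (trans (cong +_ eq) (ℤP.pos-* m′ (suc n)))))

  ℕ→ℚ-* : ∀ m n → ℕ→ℚ (m ℕ.* n) ≡ ℕ→ℚ m * ℕ→ℚ n
  ℕ→ℚ-* m n = sym (frac-* m 0 n 0)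

  ℕ→ℚ-*-recip : ∀ n → ℕ→ℚ (suc n) * recip (suc n) ≡ 1ℚ
  ℕ→ℚ-*-recip n = trans (frac-* (suc n) 0 1 n) (frac-≡ (suc n ℕ.* 1) (n ℕ.+ 0) 1 0 (ℕ-Solver.solve (n ∷ [])))

  /-as-*-recip : ∀ m n → + m ℚ./ suc n ≡ ℕ→ℚ m * recip (suc n)
  /-as-*-recip m n = sym (trans (frac-* m 0 1 n) (frac-≡ (m ℕ.* 1) (n ℕ.+ 0) m n (ℕ-Solver.solve (m ∷ n ∷ []))))

module Matrices where
  open import Data.Rational using (_*_; _+_; _-_; -_; 1/_)
  open ≡ using (_≡_; refl; sym; trans; cong; subst; module ≡-Reasoning)
  open Rationals using (ℚ-ring; ≡-by-units; *-≡1)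

  mat-cong : ∀ {a₁ b₁ c₁ d₁ a₂ b₂ c₂ d₂} →
             a₁ ≡ a₂ → b₁ ≡ b₂ → c₁ ≡ c₂ → d₁ ≡ d₂ → mat a₁ b₁ c₁ d₁ ≡ mat a₂ b₂ c₂ d₂
  mat-cong refl refl refl refl = refl

  gl-cong : ∀ {g h} → mat⁺ g ≡ mat⁺ h → g ≡ h
  gl-cong refl = refl

  det-· : ∀ m n → det (m · n) ≡ det m * det n
  det-· (mat a₁ b₁ c₁ d₁) (mat a₂ b₂ c₂ d₂) = expanded
    where
    expanded : (a₁ * a₂ + b₁ * c₂) * (c₁ * b₂ + d₁ * d₂) - (a₁ * b₂ + b₁ * d₂) * (c₁ * a₂ + d₁ * c₂)
             ≡ (a₁ * d₁ - b₁ * c₁) * (a₂ * d₂ - b₂ * c₂)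
    expanded = solve (a₁ ∷ b₁ ∷ c₁ ∷ d₁ ∷ a₂ ∷ b₂ ∷ c₂ ∷ d₂ ∷ []) ℚ-ring

  _·⁺_ : GL⁺ → GL⁺ → GL⁺
  gl m p ·⁺ gl n q = gl (m · n) (subst Positive (sym (det-· m n)) (ℚP.pos*pos⇒pos (det m) {{p}} (det n) {{q}}))

  ut·ut : ∀ x y z x′ y′ z′ → mat x y 0ℚ z · mat x′ y′ 0ℚ z′ ≡ mat (x * x′) (x * y′ + y * z′) 0ℚ (z * z′)
  ut·ut x y z x′ y′ z′ =
    mat-cong (solve (x ∷ y ∷ x′ ∷ []) ℚ-ring) refl (solve (z ∷ x′ ∷ []) ℚ-ring) (solve (z ∷ y′ ∷ z′ ∷ []) ℚ-ring)

  -- u stands for 1/ det, abstracted so that the ring solver sees it as a variable.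
  upperTriangular-inverse : ∀ a a⁻¹ d₁ d₁⁻¹ d d⁻¹ c u →
    a * a⁻¹ ≡ 1ℚ → d₁ * d₁⁻¹ ≡ 1ℚ → d * d⁻¹ ≡ 1ℚ → (a * (d₁ * d) - c * d₁ * 0ℚ) * u ≡ 1ℚ →
    mat a⁻¹ 0ℚ 0ℚ 1ℚ · (mat 1ℚ 0ℚ 0ℚ d₁⁻¹ · mat 1ℚ (- (c * d⁻¹)) 0ℚ d⁻¹)
      ≡ mat ((d₁ * d) * u) ((- (c * d₁)) * u) ((- 0ℚ) * u) (a * u)
  upperTriangular-inverse a a⁻¹ d₁ d₁⁻¹ d d⁻¹ c u aa⁻¹≡1 d₁d₁⁻¹≡1 dd⁻¹≡1 Δu≡1 = begin
    mat a⁻¹ 0ℚ 0ℚ 1ℚ · (mat 1ℚ 0ℚ 0ℚ d₁⁻¹ · mat 1ℚ (- (c * d⁻¹)) 0ℚ d⁻¹)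
      ≡⟨ cong (mat a⁻¹ 0ℚ 0ℚ 1ℚ ·_) (ut·ut 1ℚ 0ℚ d₁⁻¹ 1ℚ (- (c * d⁻¹)) d⁻¹) ⟩
    mat a⁻¹ 0ℚ 0ℚ 1ℚ · mat (1ℚ * 1ℚ) (1ℚ * (- (c * d⁻¹)) + 0ℚ * d⁻¹) 0ℚ (d₁⁻¹ * d⁻¹)
      ≡⟨ ut·ut a⁻¹ 0ℚ 1ℚ (1ℚ * 1ℚ) (1ℚ * (- (c * d⁻¹)) + 0ℚ * d⁻¹) (d₁⁻¹ * d⁻¹) ⟩
    mat (a⁻¹ * (1ℚ * 1ℚ)) (a⁻¹ * (1ℚ * (- (c * d⁻¹)) + 0ℚ * d⁻¹) + 0ℚ * (d₁⁻¹ * d⁻¹))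
        0ℚ (1ℚ * (d₁⁻¹ * d⁻¹))
      ≡⟨ mat-cong
          (≡-by-units Δu≡1 aa⁻¹≡1 (solve (a ∷ a⁻¹ ∷ d₁ ∷ d ∷ c ∷ u ∷ []) ℚ-ring))
          (≡-by-units Δu≡1 (*-≡1 aa⁻¹≡1 dd⁻¹≡1)
            (solve (a ∷ a⁻¹ ∷ d₁ ∷ d₁⁻¹ ∷ d ∷ d⁻¹ ∷ c ∷ u ∷ []) ℚ-ring))
          (sym (ℚP.*-zeroˡ u))
          (≡-by-units Δu≡1 (*-≡1 d₁d₁⁻¹≡1 dd⁻¹≡1)
            (solve (a ∷ d₁ ∷ d₁⁻¹ ∷ d ∷ d⁻¹ ∷ c ∷ u ∷ []) ℚ-ring)) ⟩
    mat ((d₁ * d) * u) ((- (c * d₁)) * u) ((- 0ℚ) * u) (a * u) ∎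
    where open ≡-Reasoning

  ⁻¹⁺-factorisation : ∀ g a a⁻¹ d₁ d₁⁻¹ d d⁻¹ c →
    a * a⁻¹ ≡ 1ℚ → d₁ * d₁⁻¹ ≡ 1ℚ → d * d⁻¹ ≡ 1ℚ → mat⁺ g ≡ mat a (c * d₁) 0ℚ (d₁ * d) →
    mat a⁻¹ 0ℚ 0ℚ 1ℚ · (mat 1ℚ 0ℚ 0ℚ d₁⁻¹ · mat 1ℚ (- (c * d⁻¹)) 0ℚ d⁻¹) ≡ mat⁺ (g ⁻¹⁺)
  ⁻¹⁺-factorisation (gl m p) a a⁻¹ d₁ d₁⁻¹ d d⁻¹ c aa⁻¹≡1 d₁d₁⁻¹≡1 dd⁻¹≡1 refl =
    upperTriangular-inverse a a⁻¹ d₁ d₁⁻¹ d d⁻¹ c _ aa⁻¹≡1 d₁d₁⁻¹≡1 dd⁻¹≡1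
      (ℚP.*-inverseʳ (det m) {{ℚP.pos⇒nonZero (det m) {{p}}}})

  0*q+z≡z : ∀ q z → 0ℚ * q + z ≡ z
  0*q+z≡z q z = trans (cong (_+ z) (ℚP.*-zeroˡ q)) (ℚP.+-identityˡ z)

  ut-•-fin : ∀ x y z q r → Positive z → r * z ≡ x * q + y → mat x y 0ℚ z • fin q ≡ fin r
  ut-•-fin x y z q r z>0 rz≡xq+y with 0ℚ * q + z ℚ.≟ 0ℚ
  ... | yes Δ≡0 = contradiction (ℚP.positive⁻¹ z {{z>0}}) (ℚP.<-irrefl (trans (sym Δ≡0) (0*q+z≡z q z)))
  ... | no Δ≢0 = cong fin (begin
    (x * q + y) * 1/ Δ   ≡⟨ cong (_* 1/ Δ) (sym rz≡xq+y) ⟩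
    r * z * 1/ Δ         ≡⟨ cong (λ w → r * w * 1/ Δ) (sym (0*q+z≡z q z)) ⟩
    r * Δ * 1/ Δ         ≡⟨ ℚP.*-assoc r Δ (1/ Δ) ⟩
    r * (Δ * 1/ Δ)       ≡⟨ cong (r *_) (ℚP.*-inverseʳ Δ) ⟩
    r * 1ℚ               ≡⟨ ℚP.*-identityʳ r ⟩
    r                    ∎)
    where
    open ≡-Reasoning
    Δ = 0ℚ * q + z
    instance _ = ℚ.≢-nonZero Δ≢0

  ut-•-0 : ∀ a c d₁ d d⁻¹ → d * d⁻¹ ≡ 1ℚ → Positive (d₁ * d) →
           mat a (c * d₁) 0ℚ (d₁ * d) • fin 0ℚ ≡ fin (c * d⁻¹)
  ut-•-0 a c d₁ d d⁻¹ dd⁻¹≡1 d₁d>0 = ut-•-fin a (c * d₁) (d₁ * d) 0ℚ (c * d⁻¹) d₁d>0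
    (≡-by-units refl dd⁻¹≡1 (solve (a ∷ c ∷ d₁ ∷ d ∷ d⁻¹ ∷ []) ℚ-ring))

module HeckeMatrices {c ℓ : Level} (M : GL⁺Module c ℓ) where
  open import Data.Integer using (+_)
  open Rationals using (ℕ→ℚ-*; ℕ→ℚ-*-recip; /-as-*-recip)
  open Matrices

  LM-matrix : ℕ → ℕ → GL⁺
  LM-matrix c-1 d-1 = ut 1ℚ (ℚ.- (+ suc c-1 ℚ./ suc d-1)) (recip (suc d-1)) _ (recip-pos (suc d-1))

  module _ (a-1 d₁-1 d-1 c-1 e-1 : ℕ) (d₁d≡e : suc d₁-1 ℕ.* suc d-1 ≡ suc e-1) where
    private
      A = ℕ→ℚ (suc a-1)
      C = ℕ→ℚ (suc c-1)
      D₁ = ℕ→ℚ (suc d₁-1)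
      D = ℕ→ℚ (suc d-1)

    hecke-δ : GL⁺
    hecke-δ = δ M a-1 (ℕ.pred (suc c-1 ℕ.* suc d₁-1)) e-1

    hecke-δ-entries : mat⁺ hecke-δ ≡ mat A (C ℚ.* D₁) 0ℚ (D₁ ℚ.* D)
    hecke-δ-entries = mat-cong ≡.refl (ℕ→ℚ-* (suc c-1) (suc d₁-1)) ≡.refl
      (≡.trans (≡.cong ℕ→ℚ (≡.sym d₁d≡e)) (ℕ→ℚ-* (suc d₁-1) (suc d-1)))

    hecke-δ⁻¹-factorisation : mat⁺ (Z₊ M (suc a-1) ·⁺ (Z₋ M (suc d₁-1) ·⁺ LM-matrix c-1 d-1)) ≡ mat⁺ (hecke-δ ⁻¹⁺)
    hecke-δ⁻¹-factorisation = ≡.trans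
      (≡.cong (λ x → mat⁺ (Z₊ M (suc a-1)) · (mat⁺ (Z₋ M (suc d₁-1)) · mat 1ℚ (ℚ.- x) 0ℚ (recip (suc d-1))))
              (/-as-*-recip (suc c-1) d-1))
      (⁻¹⁺-factorisation hecke-δ A (recip (suc a-1)) D₁ (recip (suc d₁-1)) D (recip (suc d-1)) C
        (ℕ→ℚ-*-recip a-1) (ℕ→ℚ-*-recip d₁-1) (ℕ→ℚ-*-recip d-1) hecke-δ-entries)

    hecke-δ-•0 : mat⁺ hecke-δ • fin 0ℚ ≡ fin (+ suc c-1 ℚ./ suc d-1)
    hecke-δ-•0 = begin
      mat⁺ hecke-δ • fin 0ℚ                     ≡⟨ ≡.cong (_• fin 0ℚ) hecke-δ-entries ⟩
      mat A (C ℚ.* D₁) 0ℚ (D₁ ℚ.* D) • fin 0ℚ   ≡⟨ ut-•-0 A C D₁ D (recip (suc d-1)) (ℕ→ℚ-*-recip d-1) D₁D>0 ⟩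
      fin (C ℚ.* recip (suc d-1))               ≡⟨ ≡.cong fin (/-as-*-recip (suc c-1) d-1) ⟨
      fin (+ suc c-1 ℚ./ suc d-1)               ∎
      where
      open ≡.≡-Reasoning
      D₁D>0 : Positive (D₁ ℚ.* D)
      D₁D>0 = ℚP.pos*pos⇒pos D₁ {{ℕ→ℚ-pos d₁-1}} D {{ℕ→ℚ-pos d-1}}

module Coefficients {c ℓ : Level} (M : GL⁺Module c ℓ) (μ : P1 → P1 → AbelianGroup.Carrier (GL⁺Module.W M)) where
  open import Data.Integer using (+_)
  open import Data.Nat using (_*_; _≟_)
  open GL⁺Module M
  open AbelianGroup W
  open FiniteSums W
  open DivisorSums W
  open Matrices using (_·⁺_; gl-cong)
  open HeckeMatrices M
  open import Relation.Binary.Reasoning.Setoid setoid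

  module Act (g : GL⁺) = Endomorphism (act g) (act-cong g) (act-∙ g)

  act-·⁺ : ∀ g h x → act (g ·⁺ h) x ≈ act g (act h x)
  act-·⁺ (gl m p) (gl n q) = act-· (gl m p) (gl n q) _

  heckeTerm : ℕ → ℕ → ℕ → Carrier
  heckeTerm a-1 d-1 b-1 = act (g ⁻¹⁺) (μ (mat⁺ g • ∞) (mat⁺ g • fin 0ℚ))
    where g = δ M a-1 b-1 d-1

  LM-term : ℕ → ℕ → Carrier
  LM-term c-1 d-1 = act (LM-matrix c-1 d-1) (μ ∞ (fin (+ suc c-1 ℚ./ suc d-1)))

  HeckeSeries-divPairs : ∀ n .{{_ : ℕ.NonZero n}} →
    HeckeSeries M μ n ≈ ∑ˡ (map (λ p → ∑[ b-1 < suc (proj₂ p) ] heckeTerm (proj₁ p) (proj₂ p) b-1) (divPairs n))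
  HeckeSeries-divPairs n = trans (∑ˡ-concatMap _ (divPairs n))
    (∑ˡ-map-cong (divPairs n) (λ p → ∑ˡ-upTo (heckeTerm (proj₁ p) (proj₂ p)) (suc (proj₂ p))))

  LM-coprime : ∀ d-1 → LM M μ (suc d-1) ≈ ∑[ c-1 < suc d-1 ] when (coprime? c-1 d-1) (LM-term c-1 d-1)
  LM-coprime d-1 = trans (∑ˡ-filter (λ c-1 → coprime? c-1 d-1) _ (upTo (suc d-1))) (∑ˡ-upTo _ (suc d-1))

  Z₊Z₋LM-term≈heckeTerm : ∀ a-1 d₁-1 d-1 c-1 e-1 → suc d₁-1 * suc d-1 ≡ suc e-1 →
    act (Z₊ M (suc a-1)) (act (Z₋ M (suc d₁-1)) (LM-term c-1 d-1)) ≈ heckeTerm a-1 e-1 (ℕ.pred (suc c-1 * suc d₁-1))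
  Z₊Z₋LM-term≈heckeTerm a-1 d₁-1 d-1 c-1 e-1 d₁d≡e = begin
    act z₊ (act z₋ (act u x))  ≈⟨ act-cong z₊ (act-·⁺ z₋ u x) ⟨
    act z₊ (act (z₋ ·⁺ u) x)   ≈⟨ act-·⁺ z₊ (z₋ ·⁺ u) x ⟨
    act (z₊ ·⁺ (z₋ ·⁺ u)) x    ≡⟨ ≡.cong₂ act (gl-cong (hecke-δ⁻¹-factorisation a-1 d₁-1 d-1 c-1 e-1 d₁d≡e))
                                              (≡.cong (μ ∞) (≡.sym (hecke-δ-•0 a-1 d₁-1 d-1 c-1 e-1 d₁d≡e))) ⟩
    heckeTerm a-1 e-1 (ℕ.pred (suc c-1 * suc d₁-1)) ∎
    where
    z₊ = Z₊ M (suc a-1)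
    z₋ = Z₋ M (suc d₁-1)
    u = LM-matrix c-1 d-1
    x = μ ∞ (fin (+ suc c-1 ℚ./ suc d-1))

  Z₊Z₋LM≈heckeTerms : ∀ a-1 d₁-1 d-1 e-1 → suc d₁-1 * suc d-1 ≡ suc e-1 →
    act (Z₊ M (suc a-1)) (act (Z₋ M (suc d₁-1)) (LM M μ (suc d-1)))
      ≈ ∑[ c-1 < suc d-1 ] when (coprime? c-1 d-1) (heckeTerm a-1 e-1 (ℕ.pred (suc c-1 * suc d₁-1)))
  Z₊Z₋LM≈heckeTerms a-1 d₁-1 d-1 e-1 d₁d≡e = begin
    act z₊ (act z₋ (LM M μ (suc d-1)))
      ≈⟨ act-cong z₊ (act-cong z₋ (LM-coprime d-1)) ⟩
    act z₊ (act z₋ (∑[ c-1 < suc d-1 ] when (coprime? c-1 d-1) (LM-term c-1 d-1)))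
      ≈⟨ act-cong z₊ (Act.φ-∑-when z₋ (suc d-1) (λ c-1 → coprime? c-1 d-1) (λ c-1 → LM-term c-1 d-1)) ⟩
    act z₊ (∑[ c-1 < suc d-1 ] when (coprime? c-1 d-1) (act z₋ (LM-term c-1 d-1)))
      ≈⟨ Act.φ-∑-when z₊ (suc d-1) (λ c-1 → coprime? c-1 d-1) (λ c-1 → act z₋ (LM-term c-1 d-1)) ⟩
    ∑[ c-1 < suc d-1 ] when (coprime? c-1 d-1) (act z₊ (act z₋ (LM-term c-1 d-1)))
      ≈⟨ ∑-cong (suc d-1) (λ c-1 _ → when-cong (coprime? c-1 d-1) (λ _ →
           Z₊Z₋LM-term≈heckeTerm a-1 d₁-1 d-1 c-1 e-1 d₁d≡e)) ⟩
    ∑[ c-1 < suc d-1 ] when (coprime? c-1 d-1) (heckeTerm a-1 e-1 (ℕ.pred (suc c-1 * suc d₁-1))) ∎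
    where
    z₊ = Z₊ M (suc a-1)
    z₋ = Z₋ M (suc d₁-1)

  Z₊⋆Z₋⋆LM≈heckeTerms : ∀ a-1 e-1 →
    act (Z₊ M (suc a-1)) (_⋆_ M (Z₋ M) (LM M μ) (suc e-1)) ≈ ∑[ b-1 < suc e-1 ] heckeTerm a-1 e-1 b-1
  Z₊⋆Z₋⋆LM≈heckeTerms a-1 e-1 = begin
    act z₊ (_⋆_ M (Z₋ M) (LM M μ) e)
      ≈⟨ act-cong z₊ (∑ˡ-divPairs e _) ⟩
    act z₊ (∑divPairs e (λ d₁-1 d-1 → act (Z₋ M (suc d₁-1)) (LM M μ (suc d-1))))
      ≈⟨ Act.φ-∑divPairs z₊ e (λ d₁-1 d-1 → act (Z₋ M (suc d₁-1)) (LM M μ (suc d-1))) ⟩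
    ∑divPairs e (λ d₁-1 d-1 → act z₊ (act (Z₋ M (suc d₁-1)) (LM M μ (suc d-1))))
      ≈⟨ ∑divPairs-cong e (λ d₁-1 d-1 → Z₊Z₋LM≈heckeTerms a-1 d₁-1 d-1 e-1) ⟩
    ∑divPairs e (λ d₁-1 d-1 → ∑[ c-1 < suc d-1 ] when (coprime? c-1 d-1) (heckeTerm a-1 e-1 (ℕ.pred (suc c-1 * suc d₁-1))))
      ≈⟨ ∑divPairs-coprime e-1 (heckeTerm a-1 e-1 ∘ ℕ.pred) ⟩
    ∑[ b-1 < e ] heckeTerm a-1 e-1 b-1 ∎
    where
    e = suc e-1
    z₊ = Z₊ M (suc a-1)

theorem3p4 : ∀ {c ℓ : Level} (M : GL⁺Module c ℓ)
               (μ : P1 → P1 → AbelianGroup.Carrier (GL⁺Module.W M)) →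
               IsPseudoMeasure M μ → IsSL2Z-Modular M μ →
               _≈ₛ_ M (_⋆_ M (Z₊ M) (_⋆_ M (Z₋ M) (LM M μ))) (HeckeSeries M μ)
theorem3p4 M μ _ _ n = begin
  _⋆_ M (Z₊ M) (_⋆_ M (Z₋ M) (LM M μ)) n
    ≈⟨ ∑ˡ-map-cong (divPairs n) (λ p → Z₊⋆Z₋⋆LM≈heckeTerms (proj₁ p) (proj₂ p)) ⟩
  ∑ˡ (map (λ p → ∑[ b-1 < suc (proj₂ p) ] heckeTerm (proj₁ p) (proj₂ p) b-1) (divPairs n))
    ≈⟨ HeckeSeries-divPairs n ⟨
  HeckeSeries M μ n ∎
  where
  open GL⁺Module M
  open AbelianGroup W
  open FiniteSums W
  open Coefficients M μ
  open import Relation.Binary.Reasoning.Setoid setoid
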